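{- Let $\Gamma$ be a context and $C$ a finite constraint set, and run the constraint resolution algorithm described below on $(C,\sigma=\varnothing)$. Then: (1) the algorithm halts, either by failing or by returning a substitution; (2) if the algorithm returns $\sigma$, then $\sigma$ is a solution for $C$ (i.e. $\sigma$ satisfies every constraint of $C$).
   Context: Let $\mathcal{S}$ be a set of sorts with a partial order $<:$ (no multiple inheritance), $\mathcal{F}$ a set of free function symbols and $\mathcal{F}_v$ a set of variadic symbols. A decorated sort is $s^g$ with $s\in\mathcal{S}$, $g\in\mathcal{F}\cup\mathcal{F}_v\cup\{?\}$; $s_1^{g_1}<:_s s_2^{g_2}$ iff $s_1<:s_2$ and ($g_1=g_2$ or $g_2=?$). Types are $\tau::=\alpha\mid s^g\mid wt$ with $\alpha$ in a set $\mathcal{V}$ of type variables and $wt$ a special sort; $<:_s$ is extended to types. Constraints are $\tau_1=_s\tau_2$ and $\tau_1<:_s\tau_2$; a substitution $\sigma$ (mapping type variables to types) satisfies $\tau_1=_s\tau_2$ if $\sigma\tau_1=\sigma\tau_2$ and $\tau_1<:_s\tau_2$ if $\sigma\tau_1<:_s\sigma\tau_2$; it is a solution for $C$ if it satisfies all constraints of $C$. $\mathcal{V}(C)$ is the set of type variables of $C$. The context $\Gamma$ contains subtype declarations $s_1^?<:_s s_2^?$; we write "$s^{g_1}<:_s s'^{g_2}\in\Gamma$" when there exist $s_1,\dots,s_n$ with $s^?<:s_1^?,\ s_1^?<:s_2^?,\dots,s_n^?<:s'^?$ all in $\Gamma$ and ($g_1=g_2$ or $g_2=?$). Below $g,g_1,g_2\in\mathcal{F}\cup\mathcal{F}_v\cup\{?\}$,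 $\uplus$ is disjoint union, and $[\alpha\mapsto\tau]C'$ is $C'$ with $\alpha$ replaced by $\tau$. Error detection rules (applied to the current constraint set; if one applies the algorithm returns fail): (E1) $\{s_1^{g_1}<:_s\alpha,\ \alpha<:_s s_2^{g_2}\}\uplus C'$ fails if $s_1^{g_1}<:_s s_2^{g_2}\notin\Gamma$. (E2) $\{s_1^{g_1}<:_s\alpha,\ s_2^{g_2}<:_s\alpha\}\uplus C'$ fails if there is no $s$ with $s_1^{g_1}<:_s s^?\in\Gamma$ and $s_2^{g_2}<:_s s^?\in\Gamma$. (E3) $\{\alpha<:_s s_1^{g_1},\ \alpha<:_s s_2^{g_2}\}\uplus C'$ fails if neither $s_1^{g_1}<:_s s_2^{g_2}\in\Gamma$ nor $s_2^{g_2}<:_s s_1^{g_1}\in\Gamma$. (E4) $\{s_1^{g_1}<:_s s_2^{g_2}\}\uplus C'$ fails if $s_1^{g_1}<:_s s_2^{g_2}\notin\Gamma$. (E5) $\{s_1^{g_1}=_s s_2^{g_2}\}\uplus C'$ fails if $s_1\ne s_2$ or $g_1\ne g_2$. Resolution rules on pairs (constraint set, substitution), applied recursively, with error detection checked after each step: (1) $\{\tau=_s\tau\}\uplus C',\sigma\Rightarrow C',\sigma$. (2) $\{\tau<:_s\tau\}\uplus C',\sigma\Rightarrow C',\sigma$. (3) $\{s_1^{g_1}<:_s s_2^{g_2}\}\uplus C',\sigma\Rightarrow C',\sigma$ if $s_1^{g_1}<:_s s_2^{g_2}\in\Gamma$. (4) $\{\alpha=_s\tau\}\uplus C',\sigma\Rightarrow[\alpha\mapsto\tau]C',\{\alpha\mapsto\tau\}\cup\sigma$.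 (5) $\{\tau=_s\alpha\}\uplus C',\sigma\Rightarrow[\alpha\mapsto\tau]C',\{\alpha\mapsto\tau\}\cup\sigma$. (6) $\{s_1^{g_1}<:_s\alpha,\ s_2^{g_2}<:_s\alpha\}\uplus C',\sigma\Rightarrow\{s^?<:_s\alpha\}\cup C',\sigma$ if there is $s$ with $s_1^{g_1}<:_s s^?\in\Gamma$ and $s_2^{g_2}<:_s s^?\in\Gamma$. (7a) $\{\alpha<:_s s_1^{g_1},\ \alpha<:_s s_2^{g_2}\}\uplus C',\sigma\Rightarrow\{\alpha<:_s s_1^{g_1}\}\cup C',\sigma$ if $s_1^{g_1}<:_s s_2^{g_2}\in\Gamma$. (7b) same left side $\Rightarrow\{\alpha<:_s s_2^{g_2}\}\cup C',\sigma$ if $s_2^{g_2}<:_s s_1^{g_1}\in\Gamma$. (8) $\{\tau_1<:_s\tau_2,\ \tau_2<:_s\tau_1\}\uplus C',\sigma\Rightarrow\{\tau_1=_s\tau_2\}\cup C',\sigma$. (9) $\{\alpha_1<:_s\alpha,\ \alpha<:_s\alpha_2\}\uplus C',\sigma\Rightarrow\{\alpha_1<:_s\alpha_2\}\cup[\alpha\mapsto\alpha_2]C',\{\alpha\mapsto\alpha_2\}\cup\sigma$. (10) $\{s^g<:_s\alpha,\ \alpha<:_s\alpha_1\}\uplus C',\sigma\Rightarrow\{s^g<:_s\alpha_1\}\cup[\alpha\mapsto\alpha_1]C',\{\alpha\mapsto\alpha_1\}\cup\sigma$. (11) $\{\alpha_1<:_s\alpha,\ \alpha<:_s s^g\}\uplus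 C',\sigma\Rightarrow\{\alpha_1<:_s s^g\}\cup[\alpha\mapsto\alpha_1]C',\{\alpha\mapsto\alpha_1\}\cup\sigma$. (12) $\{s_1^{g_1}<:_s\alpha,\ \alpha<:_s s_2^{g_2}\}\uplus C',\sigma\Rightarrow[\alpha\mapsto s_2^{g_2}]C',\{\alpha\mapsto s_2^{g_2}\}\cup\sigma$ if $s_1^{g_1}<:_s s_2^{g_2}\in\Gamma$. (13) $\{\alpha<:_s\tau\}\uplus C',\sigma\Rightarrow C',\{\alpha\mapsto\tau\}\cup\sigma$ if $\alpha\notin\mathcal{V}(C')$. (14) $\{\tau<:_s\alpha\}\uplus C',\sigma\Rightarrow C',\{\alpha\mapsto\tau\}\cup\sigma$ if $\alpha\notin\mathcal{V}(C')$. The algorithm stops: returning $\sigma$ when the constraint set becomes empty; returning fail when an error detection rule applies; returning an error when the constraint set reaches a nonempty normal form (no rule applies). "Failing" means returning fail or an error. -}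

module Defs where

open import Data.Nat using (ℕ; _≟_)
open import Data.Product using (_×_; _,_; ∃; ∃-syntax)
open import Data.Sum using (_⊎_)
open import Data.List using (List; []; _∷_)
open import Data.List.Membership.Propositional using (_∈_)
open import Data.List.Relation.Unary.All using (All)
open import Data.List.Relation.Unary.Any using (Any)
open import Data.List.Relation.Binary.Permutation.Propositional using (_↭_)
open import Relation.Binary.Construct.Closure.Transitive using (TransClosure)
open import Relation.Binary.Construct.Closure.ReflexiveTransitive using (Star)
open import Relation.Binary.PropositionalEquality using (_≡_)
open import Relation.Nullary using (¬_; yes; no)

NoMultipleInheritance : {S : Set} → (S → S → Set) → Set
NoMultipleInheritance _<:_ = ∀ {s a b} → s <: a → s <: b → a <: b ⊎ b <: a

module _ {S F Fv : Set} where

  data Deco : Set where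
    fn  : F → Deco
    vfn : Fv → Deco
    any : Deco

  TVar : Set
  TVar = ℕ

  data Ty : Set where
    var : TVar → Ty
    srt : S → Deco → Ty
    wt  : Ty

  data Constraint : Set where
    _≐_ : Ty → Ty → Constraint
    _≼_ : Ty → Ty → Constraint

  -- finite constraint (multi)sets, represented as lists up to permutation
  Constraints : Set
  Constraints = List Constraint

  -- substitutions: list of bindings, most recent first
  Subst : Set
  Subst = List (TVar × Ty)

  DecoLe : Deco → Deco → Set
  DecoLe g₁ g₂ = g₁ ≡ g₂ ⊎ g₂ ≡ any

  -- <:_s on types: on decorated sorts as in the paper, extended
  -- reflexively to all types
  data TySub (_<:_ : S → S → Set) : Ty → Ty → Set where
    sorts : ∀ {s₁ s₂ g₁ g₂} → s₁ <: s₂ → DecoLe g₁ g₂ →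
            TySub _<:_ (srt s₁ g₁) (srt s₂ g₂)
    refl  : ∀ {τ} → TySub _<:_ τ τ

  substTy : TVar → Ty → Ty → Ty
  substTy α τ (var β) with α ≟ β
  ... | yes _ = τ
  ... | no  _ = var β
  substTy α τ (srt s g) = srt s g
  substTy α τ wt = wt

  substC : TVar → Ty → Constraint → Constraint
  substC α τ (τ₁ ≐ τ₂) = substTy α τ τ₁ ≐ substTy α τ τ₂
  substC α τ (τ₁ ≼ τ₂) = substTy α τ τ₁ ≼ substTy α τ τ₂

  substCs : TVar → Ty → Constraints → Constraints
  substCs α τ [] = []
  substCs α τ (c ∷ C) = substC α τ c ∷ substCs α τ C

  -- applying a substitution {α ↦ τ} ∪ σ : first σ, then the newer binding
  applyS : Subst → Ty → Ty
  applyS [] τ = τ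
  applyS ((α , t) ∷ σ) τ = substTy α t (applyS σ τ)

  Satisfies : (S → S → Set) → Subst → Constraint → Set
  Satisfies _<:_ σ (τ₁ ≐ τ₂) = applyS σ τ₁ ≡ applyS σ τ₂
  Satisfies _<:_ σ (τ₁ ≼ τ₂) = TySub _<:_ (applyS σ τ₁) (applyS σ τ₂)

  Solution : (S → S → Set) → Subst → Constraints → Set
  Solution _<:_ σ C = All (Satisfies _<:_ σ) C

  Context : Set
  Context = List (S × S)

  Decl : Context → S → S → Set
  Decl Γ a b = (a , b) ∈ Γ

  InΓ : Context → S → Deco → S → Deco → Set
  InΓ Γ s₁ g₁ s₂ g₂ = TransClosure (Decl Γ) s₁ s₂ × DecoLe g₁ g₂

  OccTy : TVar → Ty → Set
  OccTy α τ = τ ≡ var α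

  OccC : TVar → Constraint → Set
  OccC α (τ₁ ≐ τ₂) = OccTy α τ₁ ⊎ OccTy α τ₂
  OccC α (τ₁ ≼ τ₂) = OccTy α τ₁ ⊎ OccTy α τ₂

  InV : TVar → Constraints → Set
  InV α C = Any (OccC α) C

  data Err (Γ : Context) (C : Constraints) : Set where
    e1 : ∀ {s₁ g₁ s₂ g₂ α C'} →
         C ↭ (srt s₁ g₁ ≼ var α) ∷ (var α ≼ srt s₂ g₂) ∷ C' →
         ¬ InΓ Γ s₁ g₁ s₂ g₂ → Err Γ C
    e2 : ∀ {s₁ g₁ s₂ g₂ α C'} →
         C ↭ (srt s₁ g₁ ≼ var α) ∷ (srt s₂ g₂ ≼ var α) ∷ C' →
         ¬ (∃[ s ] (InΓ Γ s₁ g₁ s any × InΓ Γ s₂ g₂ s any)) → Err Γ C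
    e3 : ∀ {s₁ g₁ s₂ g₂ α C'} →
         C ↭ (var α ≼ srt s₁ g₁) ∷ (var α ≼ srt s₂ g₂) ∷ C' →
         ¬ InΓ Γ s₁ g₁ s₂ g₂ → ¬ InΓ Γ s₂ g₂ s₁ g₁ → Err Γ C
    e4 : ∀ {s₁ g₁ s₂ g₂ C'} →
         C ↭ (srt s₁ g₁ ≼ srt s₂ g₂) ∷ C' →
         ¬ InΓ Γ s₁ g₁ s₂ g₂ → Err Γ C
    e5 : ∀ {s₁ g₁ s₂ g₂ C'} →
         C ↭ (srt s₁ g₁ ≐ srt s₂ g₂) ∷ C' →
         ¬ (s₁ ≡ s₂ × g₁ ≡ g₂) → Err Γ C

  State : Set
  State = Constraints × Subst

  data Rule (Γ : Context) : State → State → Set where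
    r1 : ∀ {C σ τ C'} → C ↭ (τ ≐ τ) ∷ C' → Rule Γ (C , σ) (C' , σ)
    r2 : ∀ {C σ τ C'} → C ↭ (τ ≼ τ) ∷ C' → Rule Γ (C , σ) (C' , σ)
    r3 : ∀ {C σ s₁ g₁ s₂ g₂ C'} → C ↭ (srt s₁ g₁ ≼ srt s₂ g₂) ∷ C' →
         InΓ Γ s₁ g₁ s₂ g₂ → Rule Γ (C , σ) (C' , σ)
    r4 : ∀ {C σ α τ C'} → C ↭ (var α ≐ τ) ∷ C' →
         Rule Γ (C , σ) (substCs α τ C' , (α , τ) ∷ σ)
    r5 : ∀ {C σ α τ C'} → C ↭ (τ ≐ var α) ∷ C' →
         Rule Γ (C , σ) (substCs α τ C' , (α , τ) ∷ σ)
    r6 : ∀ {C σ s₁ g₁ s₂ g₂ α C'} s →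
         C ↭ (srt s₁ g₁ ≼ var α) ∷ (srt s₂ g₂ ≼ var α) ∷ C' →
         InΓ Γ s₁ g₁ s any → InΓ Γ s₂ g₂ s any →
         Rule Γ (C , σ) ((srt s any ≼ var α) ∷ C' , σ)
    r7a : ∀ {C σ s₁ g₁ s₂ g₂ α C'} →
          C ↭ (var α ≼ srt s₁ g₁) ∷ (var α ≼ srt s₂ g₂) ∷ C' →
          InΓ Γ s₁ g₁ s₂ g₂ →
          Rule Γ (C , σ) ((var α ≼ srt s₁ g₁) ∷ C' , σ)
    r7b : ∀ {C σ s₁ g₁ s₂ g₂ α C'} →
          C ↭ (var α ≼ srt s₁ g₁) ∷ (var α ≼ srt s₂ g₂) ∷ C' →
          InΓ Γ s₂ g₂ s₁ g₁ →
          Rule Γ (C , σ) ((var α ≼ srt s₂ g₂) ∷ C' , σ)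
    r8 : ∀ {C σ τ₁ τ₂ C'} → C ↭ (τ₁ ≼ τ₂) ∷ (τ₂ ≼ τ₁) ∷ C' →
         Rule Γ (C , σ) ((τ₁ ≐ τ₂) ∷ C' , σ)
    r9 : ∀ {C σ α₁ α α₂ C'} →
         C ↭ (var α₁ ≼ var α) ∷ (var α ≼ var α₂) ∷ C' →
         Rule Γ (C , σ) ((var α₁ ≼ var α₂) ∷ substCs α (var α₂) C' ,
                         (α , var α₂) ∷ σ)
    r10 : ∀ {C σ s g α α₁ C'} →
          C ↭ (srt s g ≼ var α) ∷ (var α ≼ var α₁) ∷ C' →
          Rule Γ (C , σ) ((srt s g ≼ var α₁) ∷ substCs α (var α₁) C' ,
                          (α , var α₁) ∷ σ)
    r11 : ∀ {C σ s g α α₁ C'} →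
          C ↭ (var α₁ ≼ var α) ∷ (var α ≼ srt s g) ∷ C' →
          Rule Γ (C , σ) ((var α₁ ≼ srt s g) ∷ substCs α (var α₁) C' ,
                          (α , var α₁) ∷ σ)
    r12 : ∀ {C σ s₁ g₁ s₂ g₂ α C'} →
          C ↭ (srt s₁ g₁ ≼ var α) ∷ (var α ≼ srt s₂ g₂) ∷ C' →
          InΓ Γ s₁ g₁ s₂ g₂ →
          Rule Γ (C , σ) (substCs α (srt s₂ g₂) C' , (α , srt s₂ g₂) ∷ σ)
    r13 : ∀ {C σ α τ C'} → C ↭ (var α ≼ τ) ∷ C' → ¬ InV α C' →
          Rule Γ (C , σ) (C' , (α , τ) ∷ σ)
    r14 : ∀ {C σ α τ C'} → C ↭ (τ ≼ var α) ∷ C' → ¬ InV α C' →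
          Rule Γ (C , σ) (C' , (α , τ) ∷ σ)

  Step : Context → State → State → Set
  Step Γ (C , σ) t = ¬ Err Γ C × Rule Γ (C , σ) t

  -- converse of Step, for accessibility (termination of every run)
  _⊢_⟵_ : Context → State → State → Set
  Γ ⊢ t ⟵ s = Step Γ s t

  Returns : Context → Constraints → Subst → Set
  Returns Γ C σ = Star (Step Γ) (C , []) ([] , σ)

module Submission where

-- Every resolution rule removes at least one constraint, so the length of the
-- constraint set bounds every run.  For soundness, read a run backwards: a rule
-- that records a binding α ↦ τ has substituted τ for α in the remaining
-- constraints, so a solution ρ of its result, extended by α ↦ τ, solves the
-- constraints the rule consumed; the rules without a binding only replace
-- constraints by stronger ones, transitivity of subtyping being the key case.

open import Defs
open import Data.Product using (_×_; _,_; proj₁; proj₂; ∃-syntax)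
open import Data.Sum using (_⊎_; inj₁; inj₂)
open import Data.List using ([]; _∷_; _++_; _∷ʳ_; length)
open import Data.List.Properties using (∷ʳ-++; ++-identityʳ)
open import Data.List.Membership.Propositional using (_∈_)
open import Data.List.Relation.Unary.All using ([]; _∷_)
open import Data.List.Relation.Unary.Any using (here; there)
open import Data.List.Relation.Binary.Permutation.Propositional using (_↭_; ↭-sym)
open import Data.List.Relation.Binary.Permutation.Propositional.Properties
  using (All-resp-↭; ↭-length)
open import Data.Nat using (ℕ; suc; _<_; _≟_)
open import Data.Nat.Properties using (≤-refl; <-trans; n<1+n)
open import Data.Nat.Induction using (<-wellFounded)
open import Data.Empty using (⊥-elim)
open import Function using (_∘_; _on_)
open import Relation.Nullary using (¬_; yes; no)
open import Relation.Binary.Definitions using (Transitive)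
open import Relation.Binary.PropositionalEquality
  using (_≡_; refl; sym; trans; cong; cong₂; subst; subst₂)
open import Relation.Binary.Structures using (IsPartialOrder)
open import Relation.Binary.Construct.Closure.Transitive using (TransClosure; [_]; _∷_)
open import Relation.Binary.Construct.Closure.ReflexiveTransitive using (Star; ε; _◅_)
open import Relation.Binary.Construct.On using (wellFounded)
open import Induction.WellFounded using (WellFounded; Acc; module Subrelation)

module _ {S F Fv : Set} where

  private
    Type = Ty {S} {F} {Fv}
    Cs   = Constraints {S} {F} {Fv}
    Sb   = Subst {S} {F} {Fv}

  substTy-bound : ∀ α (τ : Type) → substTy α τ (var α) ≡ τ
  substTy-bound α τ with α ≟ α
  ... | yes _  = refl
  ... | no α≢α = ⊥-elim (α≢α refl)

  substTy-fresh : ∀ α (τ x : Type) → ¬ x ≡ var α → substTy α τ x ≡ x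
  substTy-fresh α τ (var β) x≢α with α ≟ β
  ... | yes refl = ⊥-elim (x≢α refl)
  ... | no _     = refl
  substTy-fresh α τ (srt s g) _ = refl
  substTy-fresh α τ wt        _ = refl

  substTy-kept-or-replaced : ∀ α (τ x : Type) → substTy α τ x ≡ x ⊎ substTy α τ x ≡ τ
  substTy-kept-or-replaced α τ (var β) with α ≟ β
  ... | yes _ = inj₂ refl
  ... | no  _ = inj₁ refl
  substTy-kept-or-replaced α τ (srt s g) = inj₁ refl
  substTy-kept-or-replaced α τ wt        = inj₁ refl

  substC-fresh : ∀ α (τ : Type) c → ¬ OccC α c → substC α τ c ≡ c
  substC-fresh α τ (a ≐ b) α∉ =
    cong₂ _≐_ (substTy-fresh α τ a (α∉ ∘ inj₁)) (substTy-fresh α τ b (α∉ ∘ inj₂))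
  substC-fresh α τ (a ≼ b) α∉ =
    cong₂ _≼_ (substTy-fresh α τ a (α∉ ∘ inj₁)) (substTy-fresh α τ b (α∉ ∘ inj₂))

  substCs-fresh : ∀ α (τ : Type) (C : Cs) → ¬ InV α C → substCs α τ C ≡ C
  substCs-fresh α τ []      _  = refl
  substCs-fresh α τ (c ∷ C) α∉ =
    cong₂ _∷_ (substC-fresh α τ c (α∉ ∘ here)) (substCs-fresh α τ C (α∉ ∘ there))

  length-substCs : ∀ α (τ : Type) (C : Cs) → length (substCs α τ C) ≡ length C
  length-substCs α τ []      = refl
  length-substCs α τ (c ∷ C) = cong suc (length-substCs α τ C)

  applyS-srt : ∀ (ρ : Sb) s g → applyS ρ (srt s g) ≡ srt s g
  applyS-srt []            s g = refl
  applyS-srt ((α , τ) ∷ ρ) s g = cong (substTy α τ) (applyS-srt ρ s g)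

  applyS-++ : ∀ (ρ σ : Sb) x → applyS (ρ ++ σ) x ≡ applyS ρ (applyS σ x)
  applyS-++ []            σ x = refl
  applyS-++ ((α , τ) ∷ ρ) σ x = cong (substTy α τ) (applyS-++ ρ σ x)

  size : State {S} {F} {Fv} → ℕ
  size = length ∘ proj₁

  shorter : ∀ {C C' : Cs} {c} → C ↭ c ∷ C' → length C' < length C
  shorter p rewrite ↭-length p = ≤-refl

  shorter-substCs : ∀ {C C' : Cs} {c} α τ → C ↭ c ∷ C' → length (substCs α τ C') < length C
  shorter-substCs {C' = C'} α τ p rewrite length-substCs α τ C' = shorter p

  -- In (9)–(11) the added constraint stands in for the second consumed one.
  Rule-shrinks : ∀ {Γ s t} → Rule Γ s t → size t < size s
  Rule-shrinks (r1 p)                         = shorter p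
  Rule-shrinks (r2 p)                         = shorter p
  Rule-shrinks (r3 p _)                       = shorter p
  Rule-shrinks (r4 {α = α} {τ} p)             = shorter-substCs α τ p
  Rule-shrinks (r5 {α = α} {τ} p)             = shorter-substCs α τ p
  Rule-shrinks (r6 _ p _ _)                   = shorter p
  Rule-shrinks (r7a p _)                      = shorter p
  Rule-shrinks (r7b p _)                      = shorter p
  Rule-shrinks (r8 p)                         = shorter p
  Rule-shrinks (r9 {α = α} {α₂} p)            = shorter-substCs α (var α₂) p
  Rule-shrinks (r10 {α = α} {α₁} p)           = shorter-substCs α (var α₁) p
  Rule-shrinks (r11 {α = α} {α₁} p)           = shorter-substCs α (var α₁) p
  Rule-shrinks (r12 {s₂ = s₂} {g₂} {α} p _)   = <-trans (n<1+n _) (shorter-substCs α (srt s₂ g₂) p)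
  Rule-shrinks (r13 p _)                      = shorter p
  Rule-shrinks (r14 p _)                      = shorter p

  Step-wellFounded : (Γ : Context {S} {F} {Fv}) → WellFounded (Γ ⊢_⟵_)
  Step-wellFounded Γ = Sub.wellFounded (wellFounded size <-wellFounded)
    where module Sub = Subrelation {_<₁_ = Γ ⊢_⟵_} {_<₂_ = _<_ on size}
                                  (λ {t} {s} step → Rule-shrinks {Γ} {s} {t} (proj₂ step))

module Soundness {S F Fv : Set} (_<:_ : S → S → Set) (<:-trans : Transitive _<:_)
                 (Γ : Context {S} {F} {Fv}) (Γ-sound : ∀ {a b} → (a , b) ∈ Γ → a <: b) where

  private
    Type = Ty {S} {F} {Fv}
    Cs   = Constraints {S} {F} {Fv}
    Sb   = Subst {S} {F} {Fv}

    _⊑_ : Type → Type → Set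
    _⊑_ = TySub _<:_

    Solves : Sb → Cs → Set
    Solves = Solution _<:_

  DecoLe-trans : Transitive (DecoLe {S} {F} {Fv})
  DecoLe-trans (inj₁ refl) g₂≤g₃       = g₂≤g₃
  DecoLe-trans (inj₂ refl) (inj₁ refl) = inj₂ refl
  DecoLe-trans (inj₂ _)    (inj₂ g₃≡?) = inj₂ g₃≡?

  ⊑-trans : Transitive _⊑_
  ⊑-trans (sorts s₁<:s₂ g₁≤g₂) (sorts s₂<:s₃ g₂≤g₃) =
    sorts (<:-trans s₁<:s₂ s₂<:s₃) (DecoLe-trans g₁≤g₂ g₂≤g₃)
  ⊑-trans a⊑b refl = a⊑b
  ⊑-trans refl b⊑c = b⊑c

  ≡⇒⊑ : ∀ {a b} → a ≡ b → a ⊑ b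
  ≡⇒⊑ refl = refl

  Decl⁺⇒<: : ∀ {a b} → TransClosure (Decl {S} {F} {Fv} Γ) a b → a <: b
  Decl⁺⇒<: [ a∈Γ ]       = Γ-sound a∈Γ
  Decl⁺⇒<: (a∈Γ ∷ b⁺c) = <:-trans (Γ-sound a∈Γ) (Decl⁺⇒<: b⁺c)

  InΓ⇒⊑ : ∀ ρ {s₁ g₁ s₂ g₂} → InΓ Γ s₁ g₁ s₂ g₂ → applyS ρ (srt s₁ g₁) ⊑ applyS ρ (srt s₂ g₂)
  InΓ⇒⊑ ρ {s₁} {g₁} {s₂} {g₂} (s₁⁺s₂ , g₁≤g₂)
    rewrite applyS-srt ρ s₁ g₁ | applyS-srt ρ s₂ g₂ = sorts (Decl⁺⇒<: s₁⁺s₂) g₁≤g₂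

  applyS-∷ʳ : ∀ ρ α (τ x : Type) → applyS (ρ ∷ʳ (α , τ)) x ≡ applyS ρ (substTy α τ x)
  applyS-∷ʳ ρ α τ = applyS-++ ρ ((α , τ) ∷ [])

  applyS-∷ʳ-kept-or-replaced : ∀ ρ α (τ x : Type) →
    applyS (ρ ∷ʳ (α , τ)) x ≡ applyS ρ x ⊎ applyS (ρ ∷ʳ (α , τ)) x ≡ applyS ρ τ
  applyS-∷ʳ-kept-or-replaced ρ α τ x with substTy-kept-or-replaced α τ x
  ... | inj₁ kept     = inj₁ (trans (applyS-∷ʳ ρ α τ x) (cong (applyS ρ) kept))
  ... | inj₂ replaced = inj₂ (trans (applyS-∷ʳ ρ α τ x) (cong (applyS ρ) replaced))

  applyS-∷ʳ-bound : ∀ ρ α (τ : Type) → applyS (ρ ∷ʳ (α , τ)) (var α) ≡ applyS ρ τ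
  applyS-∷ʳ-bound ρ α τ = trans (applyS-∷ʳ ρ α τ (var α)) (cong (applyS ρ) (substTy-bound α τ))

  applyS-∷ʳ-target : ∀ ρ α (τ : Type) → applyS (ρ ∷ʳ (α , τ)) τ ≡ applyS ρ τ
  applyS-∷ʳ-target ρ α τ with applyS-∷ʳ-kept-or-replaced ρ α τ τ
  ... | inj₁ kept     = kept
  ... | inj₂ replaced = replaced

  applyS-∷ʳ-unifies : ∀ ρ α (τ : Type) → applyS (ρ ∷ʳ (α , τ)) (var α) ≡ applyS (ρ ∷ʳ (α , τ)) τ
  applyS-∷ʳ-unifies ρ α τ = trans (applyS-∷ʳ-bound ρ α τ) (sym (applyS-∷ʳ-target ρ α τ))

  Satisfies-∷ʳ : ∀ ρ α τ c → Satisfies _<:_ ρ (substC α τ c) → Satisfies _<:_ (ρ ∷ʳ (α , τ)) c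
  Satisfies-∷ʳ ρ α τ (a ≐ b) ρ⊨c =
    trans (applyS-∷ʳ ρ α τ a) (trans ρ⊨c (sym (applyS-∷ʳ ρ α τ b)))
  Satisfies-∷ʳ ρ α τ (a ≼ b) ρ⊨c =
    subst₂ _⊑_ (sym (applyS-∷ʳ ρ α τ a)) (sym (applyS-∷ʳ ρ α τ b)) ρ⊨c

  Solution-∷ʳ : ∀ ρ α τ (C : Cs) → Solves ρ (substCs α τ C) → Solves (ρ ∷ʳ (α , τ)) C
  Solution-∷ʳ ρ α τ []      []         = []
  Solution-∷ʳ ρ α τ (c ∷ C) (ρ⊨c ∷ ρ⊨C) = Satisfies-∷ʳ ρ α τ c ρ⊨c ∷ Solution-∷ʳ ρ α τ C ρ⊨C

  Solution-∷ʳ-fresh : ∀ ρ α τ (C : Cs) → ¬ InV α C → Solves ρ C → Solves (ρ ∷ʳ (α , τ)) C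
  Solution-∷ʳ-fresh ρ α τ C α∉C ρ⊨C =
    Solution-∷ʳ ρ α τ C (subst (Solves ρ) (sym (substCs-fresh α τ C α∉C)) ρ⊨C)

  -- Resolving a ≼ α ≼ b into a ≼ b and binding α to the upper bound b
  -- (rules 9, 10, 12) or to the lower bound a (rule 11).
  Solution-bind-upper : ∀ ρ α {a b : Type} {C} → applyS ρ a ⊑ applyS ρ b →
    Solves (ρ ∷ʳ (α , b)) C → Solves (ρ ∷ʳ (α , b)) ((a ≼ var α) ∷ (var α ≼ b) ∷ C)
  Solution-bind-upper ρ α {a} {b} a⊑b ρ′⊨C = a⊑α ∷ ≡⇒⊑ (applyS-∷ʳ-unifies ρ α b) ∷ ρ′⊨C
    where
    a⊑b′ : applyS (ρ ∷ʳ (α , b)) a ⊑ applyS ρ b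
    a⊑b′ with applyS-∷ʳ-kept-or-replaced ρ α b a
    ... | inj₁ kept     = subst (_⊑ _) (sym kept) a⊑b
    ... | inj₂ replaced = ≡⇒⊑ replaced
    a⊑α : applyS (ρ ∷ʳ (α , b)) a ⊑ applyS (ρ ∷ʳ (α , b)) (var α)
    a⊑α = subst (applyS (ρ ∷ʳ (α , b)) a ⊑_) (sym (applyS-∷ʳ-bound ρ α b)) a⊑b′

  Solution-bind-lower : ∀ ρ α {a b : Type} {C} → applyS ρ a ⊑ applyS ρ b →
    Solves (ρ ∷ʳ (α , a)) C → Solves (ρ ∷ʳ (α , a)) ((a ≼ var α) ∷ (var α ≼ b) ∷ C)
  Solution-bind-lower ρ α {a} {b} a⊑b ρ′⊨C = ≡⇒⊑ (sym (applyS-∷ʳ-unifies ρ α a)) ∷ α⊑b ∷ ρ′⊨C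
    where
    a⊑b′ : applyS ρ a ⊑ applyS (ρ ∷ʳ (α , a)) b
    a⊑b′ with applyS-∷ʳ-kept-or-replaced ρ α a b
    ... | inj₁ kept     = subst (_ ⊑_) (sym kept) a⊑b
    ... | inj₂ replaced = ≡⇒⊑ (sym replaced)
    α⊑b : applyS (ρ ∷ʳ (α , a)) (var α) ⊑ applyS (ρ ∷ʳ (α , a)) b
    α⊑b = subst (_⊑ applyS (ρ ∷ʳ (α , a)) b) (sym (applyS-∷ʳ-bound ρ α a)) a⊑b′

  Solution-↭ : ∀ {ρ} {C D : Cs} → C ↭ D → Solves ρ D → Solves ρ C
  Solution-↭ C↭D = All-resp-↭ (↭-sym C↭D)

  Completes : Sb → State {S} {F} {Fv} → Set
  Completes σf (C , σ) = ∃[ ρ ] σf ≡ ρ ++ σ × Solves ρ C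

  Completes-back : ∀ {σf σ} {C C' : Cs} → (∀ ρ → Solves ρ C' → Solves ρ C) →
                   Completes σf (C' , σ) → Completes σf (C , σ)
  Completes-back C'⇒C (ρ , σf≡ρσ , ρ⊨C') = ρ , σf≡ρσ , C'⇒C ρ ρ⊨C'

  Completes-back-bind : ∀ {σf σ} {C C' : Cs} x → (∀ ρ → Solves ρ C' → Solves (ρ ∷ʳ x) C) →
                        Completes σf (C' , x ∷ σ) → Completes σf (C , σ)
  Completes-back-bind x C'⇒C (ρ , σf≡ρxσ , ρ⊨C') =
    ρ ∷ʳ x , trans σf≡ρxσ (sym (∷ʳ-++ ρ x _)) , C'⇒C ρ ρ⊨C'

  Rule-sound : ∀ {s t σf} → Rule Γ s t → Completes σf t → Completes σf s
  Rule-sound (r1 p) = Completes-back λ ρ ρ⊨C' → Solution-↭ p (refl ∷ ρ⊨C')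
  Rule-sound (r2 p) = Completes-back λ ρ ρ⊨C' → Solution-↭ p (refl ∷ ρ⊨C')
  Rule-sound (r3 p s₁⊑s₂) = Completes-back λ ρ ρ⊨C' → Solution-↭ p (InΓ⇒⊑ ρ s₁⊑s₂ ∷ ρ⊨C')
  Rule-sound (r4 {α = α} {τ} {C'} p) = Completes-back-bind (α , τ) λ ρ ρ⊨C' →
    Solution-↭ p (applyS-∷ʳ-unifies ρ α τ ∷ Solution-∷ʳ ρ α τ C' ρ⊨C')
  Rule-sound (r5 {α = α} {τ} {C'} p) = Completes-back-bind (α , τ) λ ρ ρ⊨C' →
    Solution-↭ p (sym (applyS-∷ʳ-unifies ρ α τ) ∷ Solution-∷ʳ ρ α τ C' ρ⊨C')
  Rule-sound (r6 s p s₁⊑s s₂⊑s) = Completes-back λ { ρ (s⊑α ∷ ρ⊨C') →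
    Solution-↭ p (⊑-trans (InΓ⇒⊑ ρ s₁⊑s) s⊑α ∷ ⊑-trans (InΓ⇒⊑ ρ s₂⊑s) s⊑α ∷ ρ⊨C') }
  Rule-sound (r7a p s₁⊑s₂) = Completes-back λ { ρ (α⊑s₁ ∷ ρ⊨C') →
    Solution-↭ p (α⊑s₁ ∷ ⊑-trans α⊑s₁ (InΓ⇒⊑ ρ s₁⊑s₂) ∷ ρ⊨C') }
  Rule-sound (r7b p s₂⊑s₁) = Completes-back λ { ρ (α⊑s₂ ∷ ρ⊨C') →
    Solution-↭ p (⊑-trans α⊑s₂ (InΓ⇒⊑ ρ s₂⊑s₁) ∷ α⊑s₂ ∷ ρ⊨C') }
  Rule-sound (r8 p) = Completes-back λ { ρ (τ₁≡τ₂ ∷ ρ⊨C') →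
    Solution-↭ p (≡⇒⊑ τ₁≡τ₂ ∷ ≡⇒⊑ (sym τ₁≡τ₂) ∷ ρ⊨C') }
  Rule-sound (r9 {α = α} {α₂} {C'} p) =
    Completes-back-bind (α , var α₂) λ { ρ (α₁⊑α₂ ∷ ρ⊨C') →
    Solution-↭ p (Solution-bind-upper ρ α α₁⊑α₂ (Solution-∷ʳ ρ α (var α₂) C' ρ⊨C')) }
  Rule-sound (r10 {α = α} {α₁} {C'} p) =
    Completes-back-bind (α , var α₁) λ { ρ (s⊑α₁ ∷ ρ⊨C') →
    Solution-↭ p (Solution-bind-upper ρ α s⊑α₁ (Solution-∷ʳ ρ α (var α₁) C' ρ⊨C')) }
  Rule-sound (r11 {α = α} {α₁} {C'} p) =
    Completes-back-bind (α , var α₁) λ { ρ (α₁⊑s ∷ ρ⊨C') →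
    Solution-↭ p (Solution-bind-lower ρ α α₁⊑s (Solution-∷ʳ ρ α (var α₁) C' ρ⊨C')) }
  Rule-sound (r12 {s₂ = s₂} {g₂} {α} {C'} p s₁⊑s₂) =
    Completes-back-bind (α , srt s₂ g₂) λ ρ ρ⊨C' →
    Solution-↭ p (Solution-bind-upper ρ α (InΓ⇒⊑ ρ s₁⊑s₂) (Solution-∷ʳ ρ α (srt s₂ g₂) C' ρ⊨C'))
  Rule-sound (r13 {α = α} {τ} {C'} p α∉C') = Completes-back-bind (α , τ) λ ρ ρ⊨C' →
    Solution-↭ p (≡⇒⊑ (applyS-∷ʳ-unifies ρ α τ) ∷ Solution-∷ʳ-fresh ρ α τ C' α∉C' ρ⊨C')
  Rule-sound (r14 {α = α} {τ} {C'} p α∉C') = Completes-back-bind (α , τ) λ ρ ρ⊨C' →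
    Solution-↭ p (≡⇒⊑ (sym (applyS-∷ʳ-unifies ρ α τ)) ∷ Solution-∷ʳ-fresh ρ α τ C' α∉C' ρ⊨C')

  Run-sound : ∀ {s σf} → Star (Step Γ) s ([] , σf) → Completes σf s
  Run-sound ε              = [] , refl , []
  Run-sound (step ◅ steps) = Rule-sound (proj₂ step) (Run-sound steps)

  Returns⇒Solution : ∀ C σ → Returns Γ C σ → Solves σ C
  Returns⇒Solution C σ run with Run-sound run
  ... | ρ , σ≡ρ++[] , ρ⊨C = subst (λ σ′ → Solves σ′ C) (sym (trans σ≡ρ++[] (++-identityʳ ρ))) ρ⊨C

-- Neither termination nor soundness needs the absence of multiple inheritance,
-- nor antisymmetry of the subsort order.
theorem3 : (S F Fv : Set) (_<:_ : S → S → Set) →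
           IsPartialOrder _≡_ _<:_ →
           NoMultipleInheritance _<:_ →
           (Γ : Context {S} {F} {Fv}) →
           (∀ {a b} → (a , b) ∈ Γ → a <: b) →
           (C : Constraints {S} {F} {Fv}) →
           Acc (Γ ⊢_⟵_) (C , [])
           × (∀ σ → Returns Γ C σ → Solution _<:_ σ C)
theorem3 S F Fv _<:_ <:-isPartialOrder _ Γ Γ-sound C =
  Step-wellFounded Γ (C , []) , Returns⇒Solution C
  where open Soundness _<:_ (IsPartialOrder.trans <:-isPartialOrder) Γ Γ-sound
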